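{- Let $m,n$ be positive integers with $n\geq 2m+2$, and let $\mathcal{G}=\{G_1,\ldots,G_{m+1}\}$ be a family of graphs on the common vertex set $[n]$. If one of the following holds, then $\mathcal{G}$ admits a rainbow matching: (1) $G_i\simeq A^{m+1}_{n,m}$ for every $1\leq i\leq m+1$, and there exist $p,q\in[m+1]$ with $W_p\neq W_q$, where $W_i=\{x\in[n]: d_{G_i}(x)=n-1\}$; (2) $G_i\simeq A^{1}_{n,m}$ for every $1\leq i\leq m+1$, and there exist $p,q\in[m+1]$ with $U_p\neq U_q$, where $U_i=\{x\in[n]: d_{G_i}(x)=2m\}$.
   Context: A rainbow matching for $\{G_1,\ldots,G_t\}$ (graphs on the same vertex set) is a set of $t$ pairwise disjoint edges $e_1,\ldots,e_t$ with $e_i\in E(G_i)$. $d_G(x)$ is the degree of $x$ in $G$; $\simeq$ denotes isomorphism. $A^1_{n,m}$ is the graph on $[n]$ consisting of a clique on $[2m+1]$ and no other edges; $A^{m+1}_{n,m}$ is the graph on $[n]$ whose edges are all pairs with at least one endpoint in $[m]$. -}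

module Defs where

open import Data.Nat using (ℕ; zero; suc; _+_; _*_; _∸_; _<?_)
open import Data.Bool using (Bool; true; false; not; _∧_; _∨_; if_then_else_)
open import Data.Bool.Properties using (∧-comm; ∨-comm)
open import Data.Fin using (Fin; toℕ; _≟_)
open import Data.Fin.Permutation using (Permutation′; _⟨$⟩ʳ_)
open import Data.Fin.Subset using (Subset)
open import Data.List using (List; map)
open import Data.Nat.ListAction using (sum)
open import Data.Vec using (tabulate)
open import Data.Product using (_×_; _,_; proj₁; proj₂)
open import Relation.Nullary using (¬_; yes; no; does)
open import Relation.Binary.PropositionalEquality using (_≡_; _≢_; refl; sym; cong₂)
import Data.List as L
import Data.Nat

vertices : (n : ℕ) → List (Fin n)
vertices n = L.allFin n

-- A (finite simple) graph on the vertex set Fin n (= [n], vertex i ↦ i+1):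
-- a Bool-valued adjacency relation which is symmetric and irreflexive.
record Graph (n : ℕ) : Set where
  field
    adj    : Fin n → Fin n → Bool
    adj-sym : ∀ x y → adj x y ≡ adj y x
    adj-irr : ∀ x → adj x x ≡ false
open Graph public

degree : ∀ {n} → Graph n → Fin n → ℕ
degree {n} G x = sum (map (λ y → if adj G x y then 1 else 0) (vertices n))

_≃G_ : ∀ {n} → Graph n → Graph n → Set
_≃G_ {n} G H = Σ′ (Permutation′ n) (λ σ → ∀ x y → adj G (σ ⟨$⟩ʳ x) (σ ⟨$⟩ʳ y) ≡ adj H x y)
  where open import Data.Product using () renaming (Σ to Σ′)

neq : ∀ {n} → Fin n → Fin n → Bool
neq x y = not (does (x ≟ y))

neq-sym : ∀ {n} (x y : Fin n) → neq x y ≡ neq y x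
neq-sym x y with x ≟ y | y ≟ x
... | yes _ | yes _ = refl
... | no _  | no _  = refl
... | yes p | no q  with q (sym p)
...   | ()
neq-sym x y | no p | yes q with p (sym q)
...   | ()

neq-irr : ∀ {n} (x : Fin n) → neq x x ≡ false
neq-irr x with x ≟ x
... | yes _ = refl
... | no p with p refl
...   | ()

-- "toℕ x < k" as a boolean  (x ∈ [k] under vertex i ↦ i+1)
below : ∀ {n} → ℕ → Fin n → Bool
below k x = does (toℕ x <? k)

A1 : (n m : ℕ) → Graph n
A1 n m = record
  { adj = λ x y → neq x y ∧ (below (suc (2 * m)) x ∧ below (suc (2 * m)) y)
  ; adj-sym = λ x y → cong₂ _∧_ (neq-sym x y) (∧-comm (below (suc (2 * m)) x) _)
  ; adj-irr = λ x → cong₂ _∧_ (neq-irr x) refl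
  }

Am+1 : (n m : ℕ) → Graph n
Am+1 n m = record
  { adj = λ x y → neq x y ∧ (below m x ∨ below m y)
  ; adj-sym = λ x y → cong₂ _∧_ (neq-sym x y) (∨-comm (below m x) _)
  ; adj-irr = λ x → cong₂ _∧_ (neq-irr x) refl
  }

RainbowMatching : ∀ {n t} → (Fin t → Graph n) → Set
RainbowMatching {n} {t} G =
  Σ′ (Fin t → Fin n × Fin n) λ e →
    (∀ i → adj (G i) (proj₁ (e i)) (proj₂ (e i)) ≡ true) ×
    (∀ i j → i ≢ j →
        (proj₁ (e i) ≢ proj₁ (e j)) × (proj₁ (e i) ≢ proj₂ (e j)) ×
        (proj₂ (e i) ≢ proj₁ (e j)) × (proj₂ (e i) ≢ proj₂ (e j)))
  where open import Data.Product using () renaming (Σ to Σ′)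

Wset : ∀ {n} → Graph n → Subset n
Wset {n} G = tabulate (λ x → does (degree G x Data.Nat.≟ (n ∸ 1)))

Uset : ∀ {n} → ℕ → Graph n → Subset n
Uset {n} m G = tabulate (λ x → does (degree G x Data.Nat.≟ (2 * m)))

-- Each G i is a copy, under a vertex permutation σ i, of the model graph, so it
-- carries a core S i (the copy of [m] for A^{m+1}, of [2m+1] for A^1): in the first
-- case every core vertex is adjacent to all other vertices, in the second the core
-- is a clique. Graphs with equal cores are equal, so W p ≢ W q (or U p ≢ U q) yields
-- a vertex x ∈ S p ∖ S q. Reorder the family so that G p comes first and G q last,
-- let x be used by G p, and choose the remaining edges greedily inside the cores.
-- A core always has an unused vertex, because fewer vertices than its size are in
-- use, except at the last step, where the count is tight but the used vertex x lies
-- outside S q. For A^{m+1} the centres w i ∈ S i are chosen first and the partners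
-- afterwards, among the n - (m + 1) ≥ m + 1 vertices that are not centres.
module Submission where

open import Defs
open import Data.Bool using (Bool; true; false; _∧_; _∨_; if_then_else_)
open import Data.Bool.Properties as Bool using ()
open import Data.Empty using (⊥-elim)
open import Data.Fin using (Fin; zero; suc; toℕ; fromℕ; inject≤; _≟_)
open import Data.Fin.Properties
  using (toℕ<n; toℕ-fromℕ; toℕ-inject≤; inject≤-injective; injective⇒≤; ¬∀⟶∃¬; all?)
open import Data.Fin.Permutation
  using (Permutation′; _⟨$⟩ʳ_; _⟨$⟩ˡ_; inverseʳ; inverseˡ; transpose; flip; _∘ₚ_)
import Data.Fin.Permutation.Components as PC
open import Data.List using (List; []; _∷_; [_]; _++_; length; tabulate; lookup)
open import Data.List.Properties using (length-++; length-tabulate; map-cong)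
open import Data.Nat.ListAction using (sum)
open import Data.List.Membership.Propositional using (_∈_; _∉_)
open import Data.List.Membership.Propositional.Properties using (∈-++⁺ˡ; ∈-++⁺ʳ; ∈-tabulate⁺)
open import Data.List.Relation.Binary.Disjoint.Propositional using (Disjoint)
open import Data.List.Relation.Binary.Subset.Propositional using (_⊆_)
open import Data.List.Relation.Binary.Subset.Propositional.Properties using (⊆-refl; ⊆-trans; xs⊆ys++xs)
open import Data.List.Relation.Unary.Any using (here; there; index; any?)
open import Data.List.Relation.Unary.Any.Properties using (lookup-index)
open import Data.Nat using (ℕ; zero; suc; _+_; _*_; _∸_; _≤_; _<_; _<?_; z≤n; s≤s) renaming (_≟_ to _≟ℕ_)
open import Data.Nat.Tactic.RingSolver using (solve-∀)
open import Data.Nat.Properties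
  using (module ≤-Reasoning; ≤-trans; <-≤-trans; ≤-reflexive; n≤1+n; m≤m+n; +-comm; +-assoc; *-comm;
         *-identityʳ; *-monoˡ-≤; +-monoˡ-≤; <-irrefl)
open import Data.Product using (_×_; _,_; proj₁; proj₂; ∃-syntax)
open import Data.Sum using (_⊎_; inj₁; inj₂)
open import Data.Unit using (⊤; tt)
import Data.Vec.Functional as Vector
import Data.Vec as Vec
import Data.Vec.Properties as VecP
open import Function using (_∘_)
open import Function.Bundles using (Injection)
open import Function.Definitions using (Injective)
open import Function.Properties.Inverse using (Inverse⇒Injection)
open import Relation.Nullary using (¬_; yes; no; does)
open import Relation.Nullary.Decidable using (dec-true; dec-false)
open import Relation.Binary.PropositionalEquality
  using (_≡_; _≢_; refl; sym; trans; cong; cong₂; subst; module ≡-Reasoning)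

private
  variable
    k n t : ℕ

image-⊈ : {f : Fin k → Fin n} → Injective _≡_ _≡_ f →
  (L : List (Fin n)) → length L < k → ∃[ y ] f y ∉ L
image-⊈ {f = f} f-inj L |L|<k with all? (λ y → any? (f y ≟_) L)
... | no ¬all = ¬∀⟶∃¬ _ _ (λ y → any? (f y ≟_) L) ¬all
... | yes all = ⊥-elim (<-irrefl refl (<-≤-trans |L|<k (injective⇒≤ position-injective)))
  where
  position-injective : Injective _≡_ _≡_ (λ y → index (all y))
  position-injective {a} {b} eq = f-inj (begin
    f a                    ≡⟨ lookup-index (all a) ⟩
    lookup L (index (all a)) ≡⟨ cong (lookup L) eq ⟩
    lookup L (index (all b)) ≡⟨ lookup-index (all b) ⟨
    f b                    ∎)
    where open ≡-Reasoning

image-⊈-outside : {f : Fin k → Fin n} → Injective _≡_ _≡_ f →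
  {x : Fin n} {L : List (Fin n)} → x ∈ L → (∀ y → f y ≢ x) → length L ≤ k → ∃[ y ] f y ∉ L
image-⊈-outside {f = f} f-inj {x} {L} x∈L x∉f |L|≤k
  with image-⊈ {f = x Vector.∷ f} x∷f-injective L (s≤s |L|≤k)
  where
  x∷f-injective : Injective _≡_ _≡_ (x Vector.∷ f)
  x∷f-injective {zero}  {zero}  _  = refl
  x∷f-injective {zero}  {suc b} eq = ⊥-elim (x∉f b (sym eq))
  x∷f-injective {suc a} {zero}  eq = ⊥-elim (x∉f a eq)
  x∷f-injective {suc a} {suc b} eq = cong suc (f-inj eq)
... | zero  , x∉L = ⊥-elim (x∉L x∈L)
... | suc y , fy∉L = y , fy∉L

record HasAtLeast (k : ℕ) (S : Fin n → Bool) : Set where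
  constructor at-least
  field
    enumerate           : Fin k → Fin n
    enumerate-injective : Injective _≡_ _≡_ enumerate
    enumerate-∈         : ∀ y → S (enumerate y) ≡ true

fresh-member : {S : Fin n → Bool} → HasAtLeast k S →
  (L : List (Fin n)) → length L < k → ∃[ u ] S u ≡ true × u ∉ L
fresh-member (at-least f f-inj f∈S) L |L|<k =
  let y , fy∉L = image-⊈ f-inj L |L|<k in f y , f∈S y , fy∉L

fresh-member-outside : {S : Fin n → Bool} → HasAtLeast k S →
  {x : Fin n} {L : List (Fin n)} → x ∈ L → S x ≡ false → length L ≤ k → ∃[ u ] S u ≡ true × u ∉ L
fresh-member-outside (at-least f f-inj f∈S) x∈L x∉S |L|≤k =
  let y , fy∉L = image-⊈-outside f-inj x∈L x∉f |L|≤k in f y , f∈S y , fy∉L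
  where
  x∉f : ∀ y → f y ≢ _
  x∉f y refl with trans (sym (f∈S y)) x∉S
  ... | ()

PairwiseDisjoint : (Fin t → List (Fin n)) → Set
PairwiseDisjoint {t} B = (i j : Fin t) → i ≢ j → Disjoint (B i) (B j)

pairwiseDisjoint-∷ : {A : Set} {B : A → List (Fin n)} {a₀ : A} {c : Fin t → A} →
  (∀ i → Disjoint (B (c i)) (B a₀)) → PairwiseDisjoint (B ∘ c) → PairwiseDisjoint (B ∘ (a₀ Vector.∷ c))
pairwiseDisjoint-∷ B#B₀ B-disjoint zero    zero    0≢0 = ⊥-elim (0≢0 refl)
pairwiseDisjoint-∷ B#B₀ B-disjoint zero    (suc j) _   (v∈B₀ , v∈Bj) = B#B₀ j (v∈Bj , v∈B₀)
pairwiseDisjoint-∷ B#B₀ B-disjoint (suc i) zero    _   = B#B₀ i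
pairwiseDisjoint-∷ B#B₀ B-disjoint (suc i) (suc j) i≢j = B-disjoint i j (i≢j ∘ cong suc)

module _ {d : ℕ} {A : Set} (block : A → List (Fin n)) (length-block : ∀ a → length (block a) ≡ d) where

  -- The list L′ offered to step i is the blocks of steps 0, …, i - 1 followed by L;
  -- a step may only rely on L ⊆ L′ and on the length of L′.
  greedy : (Q : Fin t → A → Set) (L : List (Fin n)) →
    (∀ i L′ → L ⊆ L′ → length L′ ≡ toℕ i * d + length L → ∃[ a ] Q i a × Disjoint (block a) L′) →
    ∃[ c ] (∀ i → Q i (c i)) × (∀ i → Disjoint (block (c i)) L) × PairwiseDisjoint (block ∘ c)
  greedy {zero}  Q L pick = (λ ()) , (λ ()) , (λ ()) , λ ()
  greedy {suc t} Q L pick =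
    a Vector.∷ c , Q-∷ , #L-∷ , pairwiseDisjoint-∷ {B = block} c#a c-disjoint
    where
    first = pick zero L ⊆-refl refl
    a = proj₁ first
    length-shift : ∀ i → toℕ i * d + length (block a ++ L) ≡ toℕ (suc i) * d + length L
    length-shift i = begin
      toℕ i * d + length (block a ++ L)      ≡⟨ cong (toℕ i * d +_) (length-++ (block a)) ⟩
      toℕ i * d + (length (block a) + length L) ≡⟨ cong (λ l → toℕ i * d + (l + length L)) (length-block a) ⟩
      toℕ i * d + (d + length L)             ≡⟨ +-assoc (toℕ i * d) d (length L) ⟨
      toℕ i * d + d + length L               ≡⟨ cong (_+ length L) (+-comm (toℕ i * d) d) ⟩
      d + toℕ i * d + length L               ∎
      where open ≡-Reasoning
    rest = greedy (Q ∘ suc) (block a ++ L) λ i L′ aL⊆L′ len →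
      pick (suc i) L′ (⊆-trans (xs⊆ys++xs L (block a)) aL⊆L′) (trans len (length-shift i))
    c = proj₁ rest
    c#aL : ∀ i → Disjoint (block (c i)) (block a ++ L)
    c#aL = proj₁ (proj₂ (proj₂ rest))
    c#a : ∀ i → Disjoint (block (c i)) (block a)
    c#a i (v∈c , v∈a) = c#aL i (v∈c , ∈-++⁺ˡ v∈a)
    c-disjoint = proj₂ (proj₂ (proj₂ rest))
    Q-∷ : ∀ i → Q i ((a Vector.∷ c) i)
    Q-∷ zero    = proj₁ (proj₂ first)
    Q-∷ (suc i) = proj₁ (proj₂ rest) i
    #L-∷ : ∀ i → Disjoint (block ((a Vector.∷ c) i)) L
    #L-∷ zero                  = proj₂ (proj₂ first)
    #L-∷ (suc i) (v∈c , v∈L) = c#aL i (v∈c , ∈-++⁺ʳ (block a) v∈L)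

  greedy-after : (Q : Fin (suc t) → A → Set) (a₀ : A) → Q zero a₀ →
    (∀ i L′ → block a₀ ⊆ L′ → length L′ ≡ toℕ (suc i) * d → ∃[ a ] Q (suc i) a × Disjoint (block a) L′) →
    ∃[ c ] (∀ i → Q i (c i)) × PairwiseDisjoint (block ∘ c)
  greedy-after Q a₀ Qa₀ pick =
    a₀ Vector.∷ c , Q-∷ , pairwiseDisjoint-∷ {B = block} (proj₁ (proj₂ (proj₂ rest))) (proj₂ (proj₂ (proj₂ rest)))
    where
    rest = greedy (Q ∘ suc) (block a₀) λ i L′ a₀⊆L′ len →
      pick i L′ a₀⊆L′ (trans len (trans (cong (toℕ i * d +_) (length-block a₀)) (+-comm (toℕ i * d) d)))
    c = proj₁ rest
    Q-∷ : ∀ i → Q i ((a₀ Vector.∷ c) i)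
    Q-∷ zero    = Qa₀
    Q-∷ (suc i) = proj₁ (proj₂ rest) i

suc-<-or-last : (i : Fin k) → suc (toℕ i) < k ⊎ suc i ≡ fromℕ k
suc-<-or-last {suc zero}    zero    = inj₂ refl
suc-<-or-last {suc (suc k)} zero    = inj₁ (s≤s (s≤s z≤n))
suc-<-or-last {suc k}       (suc i) with suc-<-or-last i
... | inj₁ lt = inj₁ (s≤s lt)
... | inj₂ eq = inj₂ (cong suc eq)

last⇒toℕ : {i : Fin k} → suc i ≡ fromℕ k → suc (toℕ i) ≡ k
last⇒toℕ {k} eq = trans (cong toℕ eq) (toℕ-fromℕ k)

∉⇒Disjoint-[_] : (u : Fin n) {L : List (Fin n)} → u ∉ L → Disjoint [ u ] L
∉⇒Disjoint-[ u ] u∉L (here refl , u∈L) = u∉L u∈L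

ends : Fin n × Fin n → List (Fin n)
ends e = proj₁ e ∷ proj₂ e ∷ []

rainbow-of-disjoint-edges : (G : Fin t → Graph n) (e : Fin t → Fin n × Fin n) →
  (∀ i → adj (G i) (proj₁ (e i)) (proj₂ (e i)) ≡ true) → PairwiseDisjoint (ends ∘ e) →
  RainbowMatching G
rainbow-of-disjoint-edges G e e∈G e-disjoint = e , e∈G , λ i j i≢j →
  let e#e = e-disjoint i j i≢j in
    (λ eq → e#e (here refl , here eq)) , (λ eq → e#e (here refl , there (here eq))) ,
    (λ eq → e#e (there (here refl) , here eq)) , (λ eq → e#e (there (here refl) , there (here eq)))

rainbow-universal-first-last : {m : ℕ} → 2 * m + 2 ≤ n →
  (G : Fin (suc m) → Graph n) (S : Fin (suc m) → Fin n → Bool) → (∀ i → HasAtLeast m (S i)) →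
  (∀ i u v → S i u ≡ true → u ≢ v → adj (G i) u v ≡ true) →
  {x : Fin n} → S zero x ≡ true → S (fromℕ m) x ≡ false → RainbowMatching G
rainbow-universal-first-last {n} {m} 2m+2≤n G S S-size S-universal {x} x∈first x∉last =
  (λ i → w i , v i) , (λ i → S-universal i (w i) (v i) (w∈S i) (w≢v i)) ,
  λ i j i≢j → w-distinct i j i≢j , w≢v′ i j , (λ eq → w≢v′ j i (sym eq)) , v-distinct i j i≢j
  where
  pick-centre : ∀ i L′ → [ x ] ⊆ L′ → length L′ ≡ toℕ (suc i) * 1 →
    ∃[ u ] S (suc i) u ≡ true × Disjoint [ u ] L′
  pick-centre i L′ x∈L′ len with suc-<-or-last i
  ... | inj₁ lt =
    let u , u∈S , u∉L′ = fresh-member (S-size (suc i)) L′ (subst (_< m) (sym |L′|) lt)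
    in u , u∈S , ∉⇒Disjoint-[ u ] u∉L′
    where |L′| = trans len (*-identityʳ _)
  ... | inj₂ last =
    let u , u∈S , u∉L′ = fresh-member-outside (S-size (suc i)) (x∈L′ (here refl))
                           (subst (λ j → S j x ≡ false) (sym last) x∉last)
                           (≤-reflexive (trans len (trans (*-identityʳ _) (last⇒toℕ last))))
    in u , u∈S , ∉⇒Disjoint-[ u ] u∉L′
  centres = greedy-after [_] (λ _ → refl) (λ i u → S i u ≡ true) x x∈first pick-centre
  w = proj₁ centres
  w∈S = proj₁ (proj₂ centres)
  w-distinct : ∀ i j → i ≢ j → w i ≢ w j
  w-distinct i j i≢j eq = proj₂ (proj₂ centres) i j i≢j (here refl , here eq)
  R = tabulate w
  room : ∀ (i : Fin (suc m)) → toℕ i * 1 + length R < n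
  room i = begin-strict
    toℕ i * 1 + length R ≡⟨ cong₂ _+_ (*-identityʳ (toℕ i)) (length-tabulate w) ⟩
    toℕ i + suc m        <⟨ +-monoˡ-≤ (suc m) (toℕ<n i) ⟩
    suc m + suc m        ≡⟨ suc+suc m ⟩
    2 * m + 2            ≤⟨ 2m+2≤n ⟩
    n                    ∎
    where
    open ≤-Reasoning
    suc+suc : ∀ m → suc m + suc m ≡ 2 * m + 2
    suc+suc = solve-∀
  leaves = greedy [_] (λ _ → refl) (λ _ _ → ⊤) R λ i L′ _ len →
    let u , u∉L′ = image-⊈ (λ eq → eq) L′ (subst (_< n) (sym len) (room i)) in u , tt , ∉⇒Disjoint-[ u ] u∉L′
  v = proj₁ leaves
  w≢v′ : ∀ i j → w i ≢ v j
  w≢v′ i j eq = proj₁ (proj₂ (proj₂ leaves)) j (here refl , subst (_∈ R) eq (∈-tabulate⁺ {f = w} i))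
  w≢v : ∀ i → w i ≢ v i
  w≢v i = w≢v′ i i
  v-distinct : ∀ i j → i ≢ j → v i ≢ v j
  v-distinct i j i≢j eq = proj₂ (proj₂ (proj₂ leaves)) i j i≢j (here refl , here eq)

rainbow-clique-first-last : {m : ℕ} → 1 ≤ m →
  (G : Fin (suc m) → Graph n) (S : Fin (suc m) → Fin n → Bool) → (∀ i → HasAtLeast (suc (2 * m)) (S i)) →
  (∀ i u v → S i u ≡ true → S i v ≡ true → u ≢ v → adj (G i) u v ≡ true) →
  {x : Fin n} → S zero x ≡ true → S (fromℕ m) x ≡ false → RainbowMatching G
rainbow-clique-first-last {n} {m} 1≤m G S S-size S-clique {x} x∈first x∉last =
  rainbow-of-disjoint-edges G (proj₁ edges) (proj₁ (proj₂ edges)) (proj₂ (proj₂ edges))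
  where
  twice-≤ : ∀ {l} → l ≤ m → l * 2 ≤ 2 * m
  twice-≤ l≤m = ≤-trans (*-monoˡ-≤ 2 l≤m) (≤-reflexive (*-comm m 2))
  partner = fresh-member (S-size zero) [ x ] (s≤s (≤-trans 1≤m (m≤m+n m _)))
  b₀ = proj₁ partner
  first-edge : adj (G zero) x b₀ ≡ true
  first-edge = S-clique zero x b₀ x∈first (proj₁ (proj₂ partner)) λ eq → proj₂ (proj₂ partner) (here (sym eq))
  pick-edge : ∀ i L′ → ends (x , b₀) ⊆ L′ → length L′ ≡ toℕ (suc i) * 2 →
    ∃[ e ] adj (G (suc i)) (proj₁ e) (proj₂ e) ≡ true × Disjoint (ends e) L′
  pick-edge i L′ x∈L′ len = (a , b) , S-clique (suc i) a b a∈S b∈S (λ eq → b∉aL′ (here (sym eq))) , ab#L′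
    where
    Sᵢ = S (suc i)
    first-end = fresh-member (S-size (suc i)) L′ (s≤s (subst (_≤ 2 * m) (sym len) (twice-≤ (toℕ<n i))))
    a = proj₁ first-end
    a∈S = proj₁ (proj₂ first-end)
    second-end : ∃[ u ] Sᵢ u ≡ true × u ∉ a ∷ L′
    second-end with suc-<-or-last i
    ... | inj₁ lt   = fresh-member (S-size (suc i)) (a ∷ L′)
                        (s≤s (≤-trans (n≤1+n _) (subst (_≤ 2 * m) (cong suc (cong suc (sym len))) (twice-≤ lt))))
    ... | inj₂ last = fresh-member-outside (S-size (suc i)) (there (x∈L′ (here refl)))
                        (subst (λ j → S j x ≡ false) (sym last) x∉last)
                        (s≤s (≤-trans (≤-reflexive len) (twice-≤ (≤-reflexive (last⇒toℕ last)))))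
    b = proj₁ second-end
    b∈S = proj₁ (proj₂ second-end)
    b∉aL′ = proj₂ (proj₂ second-end)
    ab#L′ : Disjoint (a ∷ b ∷ []) L′
    ab#L′ (here refl , a∈L′)         = proj₂ (proj₂ first-end) a∈L′
    ab#L′ (there (here refl) , b∈L′) = b∉aL′ (there b∈L′)
  edges = greedy-after ends (λ _ → refl) (λ i e → adj (G i) (proj₁ e) (proj₂ e) ≡ true)
            (x , b₀) first-edge pick-edge

transpose-sendsˡ : (i j : Fin n) → PC.transpose i j i ≡ j
transpose-sendsˡ i j rewrite dec-true (i ≟ i) refl = refl

transpose-fixes : (i j l : Fin n) → l ≢ i → l ≢ j → PC.transpose i j l ≡ l
transpose-fixes i j l l≢i l≢j rewrite dec-false (l ≟ i) l≢i | dec-false (l ≟ j) l≢j = refl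

first-last : {p q : Fin (suc t)} → p ≢ q →
  ∃[ π ] π ⟨$⟩ʳ zero ≡ p × π ⟨$⟩ʳ fromℕ t ≡ q
first-last {zero}  {zero} {zero} p≢q = ⊥-elim (p≢q refl)
first-last {suc t} {p}    {q}    p≢q =
  transpose last q′ ∘ₚ transpose zero p ,
  trans (cong (PC.transpose zero p) (transpose-fixes last q′ zero (λ ()) q′≢0)) (transpose-sendsˡ zero p) ,
  trans (cong (PC.transpose zero p) (transpose-sendsˡ last q′)) (PC.transpose-inverse zero p)
  where
  last = fromℕ (suc t)
  -- π first swaps the last index with q′ and then 0 with p; q′ is sent to q by the latter.
  q′ = PC.transpose p zero q
  q′≢0 : zero ≢ q′
  q′≢0 eq = p≢q (begin
    p                                  ≡⟨ transpose-sendsˡ zero p ⟨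
    PC.transpose zero p zero           ≡⟨ cong (PC.transpose zero p) eq ⟩
    PC.transpose zero p q′             ≡⟨ PC.transpose-inverse zero p ⟩
    q                                  ∎)
    where open ≡-Reasoning

rainbow-reindex : (G : Fin t → Graph n) (π : Permutation′ t) →
  RainbowMatching (λ i → G (π ⟨$⟩ʳ i)) → RainbowMatching G
rainbow-reindex G π (e , e∈G , e-disjoint) =
  (λ i → e (π ⟨$⟩ˡ i)) ,
  (λ i → subst (λ j → adj (G j) (proj₁ (e (π ⟨$⟩ˡ i))) (proj₂ (e (π ⟨$⟩ˡ i))) ≡ true)
                (inverseʳ π) (e∈G (π ⟨$⟩ˡ i))) ,
  λ i j i≢j → e-disjoint _ _ λ eq →
    i≢j (trans (sym (inverseʳ π)) (trans (cong (π ⟨$⟩ʳ_) eq) (inverseʳ π)))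

wlog-first-last : (G : Fin (suc t) → Graph n) (S : Fin (suc t) → Fin n → Bool) {x : Fin n} →
  (∀ (π : Permutation′ (suc t)) → S (π ⟨$⟩ʳ zero) x ≡ true → S (π ⟨$⟩ʳ fromℕ t) x ≡ false →
    RainbowMatching (λ i → G (π ⟨$⟩ʳ i))) →
  {p q : Fin (suc t)} → S p x ≡ true → S q x ≡ false → RainbowMatching G
wlog-first-last G S {x} ordered {p} {q} x∈p x∉q =
  let π , π-first , π-last = first-last p≢q in
  rainbow-reindex G π (ordered π (subst (λ i → S i x ≡ true) (sym π-first) x∈p)
                                 (subst (λ i → S i x ≡ false) (sym π-last) x∉q))
  where
  p≢q : p ≢ q
  p≢q refl with trans (sym x∈p) x∉q
  ... | ()

permutation-injective : (π : Permutation′ n) → Injective _≡_ _≡_ (π ⟨$⟩ʳ_)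
permutation-injective π = Injection.injective (Inverse⇒Injection π)

neq-injective : {h : Fin n → Fin n} → Injective _≡_ _≡_ h → ∀ u v → neq (h u) (h v) ≡ neq u v
neq-injective {h = h} h-inj u v with u ≟ v
... | yes refl = neq-irr (h u)
... | no u≢v rewrite dec-false (h u ≟ h v) (u≢v ∘ h-inj) = refl

≢⇒neq : {u v : Fin n} → u ≢ v → neq u v ≡ true
≢⇒neq {u = u} {v} u≢v rewrite dec-false (u ≟ v) u≢v = refl

inCore : Permutation′ n → ℕ → Fin n → Bool
inCore σ k u = below k (σ ⟨$⟩ˡ u)

inCore-hasAtLeast : k ≤ n → (σ : Permutation′ n) → HasAtLeast k (inCore σ k)
inCore-hasAtLeast {k} k≤n σ = at-least f f-injective f∈core
  where
  f : Fin k → Fin _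
  f y = σ ⟨$⟩ʳ inject≤ y k≤n
  f-injective : Injective _≡_ _≡_ f
  f-injective eq = inject≤-injective k≤n k≤n _ _ (permutation-injective σ eq)
  f∈core : ∀ y → inCore σ k (f y) ≡ true
  f∈core y rewrite inverseˡ σ {inject≤ y k≤n} =
    dec-true (toℕ (inject≤ y k≤n) <? k) (subst (_< k) (sym (toℕ-inject≤ y k≤n)) (toℕ<n y))

record CoreGraph (φ : Bool → Bool → Bool) (k : ℕ) (H : Graph n) : Set where
  constructor core-graph
  field
    adj-core : ∀ x y → adj H x y ≡ neq x y ∧ φ (below k x) (below k y)

adj-≃-core : {φ : Bool → Bool → Bool} {G H : Graph n} → CoreGraph φ k H → (iso : G ≃G H) →
  ∀ u v → adj G u v ≡ neq u v ∧ φ (inCore (proj₁ iso) k u) (inCore (proj₁ iso) k v)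
adj-≃-core {k = k} {φ = φ} {G = G} {H = H} (core-graph H-core) (σ , σ-hom) u v = begin
  adj G u v                                  ≡⟨ cong₂ (adj G) (inverseʳ σ) (inverseʳ σ) ⟨
  adj G (σ ⟨$⟩ʳ (σ ⟨$⟩ˡ u)) (σ ⟨$⟩ʳ (σ ⟨$⟩ˡ v)) ≡⟨ σ-hom (σ ⟨$⟩ˡ u) (σ ⟨$⟩ˡ v) ⟩
  adj H (σ ⟨$⟩ˡ u) (σ ⟨$⟩ˡ v)                 ≡⟨ H-core (σ ⟨$⟩ˡ u) (σ ⟨$⟩ˡ v) ⟩
  neq (σ ⟨$⟩ˡ u) (σ ⟨$⟩ˡ v) ∧ φ (inCore σ k u) (inCore σ k v)
    ≡⟨ cong (_∧ φ (inCore σ k u) (inCore σ k v)) (neq-injective (permutation-injective (flip σ)) u v) ⟩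
  neq u v ∧ φ (inCore σ k u) (inCore σ k v)  ∎
  where open ≡-Reasoning

degree-cong : (G H : Graph n) {x : Fin n} → (∀ y → adj G x y ≡ adj H x y) → degree G x ≡ degree H x
degree-cong {n} G H agree = cong sum (map-cong (λ y → cong (λ b → if b then 1 else 0) (agree y)) (vertices n))

same-core⇒same-adj : {φ : Bool → Bool → Bool} {G G′ H : Graph n} → CoreGraph φ k H →
  (iso : G ≃G H) (iso′ : G′ ≃G H) → (∀ u → inCore (proj₁ iso) k u ≡ inCore (proj₁ iso′) k u) →
  ∀ u v → adj G u v ≡ adj G′ u v
same-core⇒same-adj {k = k} {φ = φ} {G} {G′} H-core iso iso′ same-core u v = begin
  adj G u v                                                    ≡⟨ adj-≃-core {G = G} H-core iso u v ⟩
  neq u v ∧ φ (inCore (proj₁ iso) k u) (inCore (proj₁ iso) k v)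
    ≡⟨ cong₂ (λ a b → neq u v ∧ φ a b) (same-core u) (same-core v) ⟩
  neq u v ∧ φ (inCore (proj₁ iso′) k u) (inCore (proj₁ iso′) k v) ≡⟨ adj-≃-core {G = G′} H-core iso′ u v ⟨
  adj G′ u v                                                   ∎
  where open ≡-Reasoning

separating-point : (S S′ : Fin n → Bool) → ¬ (∀ u → S u ≡ S′ u) →
  ∃[ x ] ((S x ≡ true × S′ x ≡ false) ⊎ (S′ x ≡ true × S x ≡ false))
separating-point S S′ S≢S′ with ¬∀⟶∃¬ _ _ (λ u → S u Bool.≟ S′ u) S≢S′
... | x , x-differs with S x in Sx | S′ x in S′x
...   | true  | true  = ⊥-elim (x-differs refl)
...   | true  | false = x , inj₁ (Sx , S′x)
...   | false | true  = x , inj₂ (S′x , Sx)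
...   | false | false = ⊥-elim (x-differs refl)

separating-vertex : {φ : Bool → Bool → Bool} {H : Graph n} → CoreGraph φ k H →
  (G : Fin t → Graph n) (iso : ∀ i → G i ≃G H) (D : ℕ → Bool) {p q : Fin t} →
  Vec.tabulate (λ x → D (degree (G p) x)) ≢ Vec.tabulate (λ x → D (degree (G q) x)) →
  ∃[ p ] ∃[ q ] ∃[ x ] inCore (proj₁ (iso p)) k x ≡ true × inCore (proj₁ (iso q)) k x ≡ false
separating-vertex {k = k} H-core G iso D {p} {q} profiles≢
  with separating-point (inCore (proj₁ (iso p)) k) (inCore (proj₁ (iso q)) k) same-core⇒same-profile
  where
  same-core⇒same-profile : ¬ (∀ u → inCore (proj₁ (iso p)) k u ≡ inCore (proj₁ (iso q)) k u)
  same-core⇒same-profile same-core = profiles≢ (VecP.tabulate-cong λ x →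
    cong D (degree-cong (G p) (G q) (same-core⇒same-adj {G = G p} {G′ = G q} H-core (iso p) (iso q) same-core x)))
... | x , inj₁ (x∈p , x∉q) = p , q , x , x∈p , x∉q
... | x , inj₂ (x∈q , x∉p) = q , p , x , x∈q , x∉p

Am+1-core : (n m : ℕ) → CoreGraph _∨_ m (Am+1 n m)
Am+1-core n m = core-graph λ _ _ → refl

A1-core : (n m : ℕ) → CoreGraph _∧_ (suc (2 * m)) (A1 n m)
A1-core n m = core-graph λ _ _ → refl

≃Am+1-universal : (m : ℕ) (G : Graph n) (iso : G ≃G Am+1 n m) →
  ∀ u v → inCore (proj₁ iso) m u ≡ true → u ≢ v → adj G u v ≡ true
≃Am+1-universal {n} m G iso u v u∈core u≢v =
  trans (adj-≃-core {G = G} (Am+1-core n m) iso u v)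
        (cong₂ (λ a b → a ∧ (b ∨ inCore (proj₁ iso) m v)) (≢⇒neq u≢v) u∈core)

≃A1-clique : (m : ℕ) (G : Graph n) (iso : G ≃G A1 n m) →
  ∀ u v → inCore (proj₁ iso) (suc (2 * m)) u ≡ true → inCore (proj₁ iso) (suc (2 * m)) v ≡ true →
  u ≢ v → adj G u v ≡ true
≃A1-clique {n} m G iso u v u∈core v∈core u≢v =
  trans (adj-≃-core {G = G} (A1-core n m) iso u v)
        (cong₂ _∧_ (≢⇒neq u≢v) (cong₂ _∧_ u∈core v∈core))

lemma5 : (m n : ℕ) → 1 ≤ m → 2 * m + 2 ≤ n → (G : Fin (suc m) → Graph n) →
    (((∀ i → G i ≃G Am+1 n m) × (∃[ p ] ∃[ q ] Wset (G p) ≢ Wset (G q)))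
     ⊎ ((∀ i → G i ≃G A1 n m) × (∃[ p ] ∃[ q ] Uset m (G p) ≢ Uset m (G q)))) →
    RainbowMatching G
lemma5 m n 1≤m 2m+2≤n G (inj₁ (iso , p , q , W≢)) =
  let _ , _ , x , x∈p , x∉q =
        separating-vertex (Am+1-core n m) G iso (λ d → does (d ≟ℕ (n ∸ 1))) {p} {q} W≢
  in wlog-first-last G S (λ π → rainbow-universal-first-last 2m+2≤n (G ∘ (π ⟨$⟩ʳ_)) (S ∘ (π ⟨$⟩ʳ_))
       (λ i → inCore-hasAtLeast m≤n (proj₁ (iso (π ⟨$⟩ʳ i))))
       (λ i → ≃Am+1-universal m (G (π ⟨$⟩ʳ i)) (iso (π ⟨$⟩ʳ i))))
     x∈p x∉q
  where
  S = λ i → inCore (proj₁ (iso i)) m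
  m≤n = ≤-trans (≤-trans (m≤m+n m (m + 0)) (m≤m+n (2 * m) 2)) 2m+2≤n
lemma5 m n 1≤m 2m+2≤n G (inj₂ (iso , p , q , U≢)) =
  let _ , _ , x , x∈p , x∉q =
        separating-vertex (A1-core n m) G iso (λ d → does (d ≟ℕ (2 * m))) {p} {q} U≢
  in wlog-first-last G S (λ π → rainbow-clique-first-last 1≤m (G ∘ (π ⟨$⟩ʳ_)) (S ∘ (π ⟨$⟩ʳ_))
       (λ i → inCore-hasAtLeast 2m+1≤n (proj₁ (iso (π ⟨$⟩ʳ i))))
       (λ i → ≃A1-clique m (G (π ⟨$⟩ʳ i)) (iso (π ⟨$⟩ʳ i))))
     x∈p x∉q
  where
  S = λ i → inCore (proj₁ (iso i)) (suc (2 * m))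
  2m+1≤n = ≤-trans (≤-trans (n≤1+n _) (≤-reflexive (+-comm 2 (2 * m)))) 2m+2≤n
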